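{- For every nonnegative integer $m$, the greedy width satisfies $\mathcal{G}(2m) \leq \max\left\{ \frac{3}{2}\sqrt{2m},\, 38\right\}$.
   Context: For an even nonnegative integer $2m$, its greedy decomposition is $2m = t_{0}(t_{0}-1) + t_{1}(t_{1}-1) + \cdots + t_{d}(t_{d}-1)$, where the $t_j$ are positive integers chosen successively, each $t_{j}$ being the largest integer with $t_{j}(t_{j}-1) \leq 2m - \sum_{i=0}^{j-1} t_{i}(t_{i}-1)$, the process stopping when the remainder is $0$ (so $2m=0$ has the empty decomposition). The greedy width is $\mathcal{G}(2m) = \sum_{j=0}^{d} t_{j}$. For example, $40 = 6\cdot 5 + 3\cdot 2 + 2\cdot 1 + 2\cdot 1$, so $\mathcal{G}(40) = 6+3+2+2 = 13$. -}

module Defs where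

open import Data.Nat using (ℕ; zero; suc; _+_; _*_; _∸_; _≤?_)
open import Relation.Nullary using (yes; no)

search : ℕ → ℕ → ℕ
search n zero = zero
search n (suc k) with suc k * k ≤? n
... | yes _ = suc k
... | no  _ = search n k

-- largestT n = the largest positive integer t with t (t - 1) ≤ n.
-- (Any such t satisfies t ≤ n + 1, so searching from n + 1 suffices; t = 1 always works.)
largestT : ℕ → ℕ
largestT n = search n (suc n)

widthFuel : ℕ → ℕ → ℕ
widthFuel zero    r       = zero
widthFuel (suc f) zero    = zero
widthFuel (suc f) (suc r) =
  let t = largestT (suc r) in t + widthFuel f (suc r ∸ t * (t ∸ 1))

-- 𝒢(2m): greedy width of the even number 2m.
-- Fuel 2m + 1 is ample: each greedy step on an even remainder r ≥ 2
-- uses t ≥ 2, hence removes at least 2, so at most m steps occur.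
G : ℕ → ℕ
G n = widthFuel (suc n) n

-- Write 2m = 2k. The greedy step takes the largest t with tri t = t(t − 1)/2 ≤ k and
-- leaves 2j with j = k − tri t < t; induct on the number of steps. If t ≤ 77, the pair
-- (t, j) ranges over a finite set and the bound is decided by evaluation, since
-- truncating the fuel only lowers the width. If t ≥ 78 and the width g of 2j obeys the
-- bound, then either g ≤ 38, and 4(t + 38)² ≤ 9t(t − 1) holds from t = 78 on, or
-- 2g² ≤ 9j < 9t forces 8g ≤ t, whence 4(t + g)² ≤ (81/16)t² ≤ 9t(t − 1).
module Submission where

open import Defs
open import Data.Nat
open import Data.Nat.Properties
open import Data.Nat.Tactic.RingSolver using (solve-∀)
open import Data.Fin using (Fin; toℕ; fromℕ<)
open import Data.Fin.Properties using (all?; toℕ-fromℕ<)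
open import Data.Product using (_×_; _,_; proj₁; proj₂)
open import Data.Sum using (_⊎_; inj₁; inj₂)
open import Relation.Nullary using (Dec; yes; no)
open import Relation.Nullary.Decidable using (_⊎-dec_; from-yes)
open import Relation.Binary.PropositionalEquality

tri : ℕ → ℕ
tri zero    = zero
tri (suc n) = n + tri n

n*[n∸1]≡2*tri : ∀ n → n * (n ∸ 1) ≡ 2 * tri n
n*[n∸1]≡2*tri zero          = refl
n*[n∸1]≡2*tri (suc zero)    = refl
n*[n∸1]≡2*tri (suc (suc n)) = begin
  suc (suc n) * suc n          ≡⟨ unfold n ⟩
  2 * suc n + suc n * n        ≡⟨ cong (2 * suc n +_) (n*[n∸1]≡2*tri (suc n)) ⟩
  2 * suc n + 2 * tri (suc n)  ≡⟨ *-distribˡ-+ 2 (suc n) (tri (suc n)) ⟨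
  2 * tri (suc (suc n))        ∎
  where
  open ≡-Reasoning
  unfold : ∀ n → suc (suc n) * suc n ≡ 2 * suc n + suc n * n
  unfold = solve-∀

search-spec : ∀ n k → n < suc k * k →
              search n k * (search n k ∸ 1) ≤ n × n < suc (search n k) * search n k
search-spec n (suc k) n<k+1*k with suc k * k ≤? n
... | yes k+1*k≤n = k+1*k≤n , n<k+1*k
... | no  k+1*k≰n = search-spec n k (≰⇒> k+1*k≰n)

largestT-spec : ∀ n → largestT n * (largestT n ∸ 1) ≤ n × n < suc (largestT n) * largestT n
largestT-spec n = search-spec n (suc n) (s≤s (m≤m+n n _))

widthFuel-mono : ∀ {f f′} → f ≤ f′ → ∀ r → widthFuel f r ≤ widthFuel f′ r
widthFuel-mono z≤n        r       = z≤n
widthFuel-mono (s≤s f≤f′) zero    = z≤n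
widthFuel-mono (s≤s f≤f′) (suc r) = +-monoʳ-≤ (largestT (suc r)) (widthFuel-mono f≤f′ _)

-- The greedy step on an even number 2k, halved: 2k = greedyPart k * (greedyPart k ∸ 1) + 2 * greedyRest k.
greedyPart : ℕ → ℕ
greedyPart k = largestT (2 * k)

greedyRest : ℕ → ℕ
greedyRest k = k ∸ tri (greedyPart k)

tri-greedyPart≤ : ∀ k → tri (greedyPart k) ≤ k
tri-greedyPart≤ k = *-cancelˡ-≤ 2
  (subst (_≤ 2 * k) (n*[n∸1]≡2*tri (greedyPart k)) (proj₁ (largestT-spec (2 * k))))

tri-greedyPart+greedyRest : ∀ k → tri (greedyPart k) + greedyRest k ≡ k
tri-greedyPart+greedyRest k = m+[n∸m]≡n (tri-greedyPart≤ k)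

greedyRest<greedyPart : ∀ k → greedyRest k < greedyPart k
greedyRest<greedyPart k = +-cancelˡ-< (tri p) (greedyRest k) p (begin-strict
  tri p + greedyRest k  ≡⟨ tri-greedyPart+greedyRest k ⟩
  k                     <⟨ *-cancelˡ-< 2 k (tri (suc p)) 2k<2*tri[p+1] ⟩
  tri (suc p)           ≡⟨ +-comm p (tri p) ⟩
  tri p + p             ∎)
  where
  open ≤-Reasoning
  p : ℕ
  p = greedyPart k
  2k<2*tri[p+1] : 2 * k < 2 * tri (suc p)
  2k<2*tri[p+1] = subst (2 * k <_) (n*[n∸1]≡2*tri (suc p)) (proj₂ (largestT-spec (2 * k)))

2≤greedyPart : ∀ k → 2 ≤ greedyPart (suc k)
2≤greedyPart k = ≮⇒≥ λ p<2 → <⇒≱ (proj₂ (largestT-spec (2 * suc k)))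
  (≤-trans (*-mono-≤ p<2 (≤-pred p<2)) (*-monoʳ-≤ 2 (s≤s z≤n)))

greedyRest<self : ∀ k → greedyRest (suc k) < suc k
greedyRest<self k = ∸-monoʳ-< (0<tri (2≤greedyPart k)) (tri-greedyPart≤ (suc k))
  where
  0<tri : ∀ {n} → 2 ≤ n → 0 < tri n
  0<tri (s≤s (s≤s _)) = s≤s z≤n

widthFuel-double : ∀ f k →
  widthFuel (suc f) (2 * suc k) ≡ greedyPart (suc k) + widthFuel f (2 * greedyRest (suc k))
widthFuel-double f k = cong (λ r → p + widthFuel f r)
  (trans (cong (2 * suc k ∸_) (n*[n∸1]≡2*tri p)) (sym (*-distribˡ-∸ 2 (suc k) (tri p))))
  where
  p : ℕ
  p = greedyPart (suc k)

widthFuel≤G : ∀ f k → widthFuel f (2 * k) ≤ G (2 * k)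
widthFuel≤G zero    k       = z≤n
widthFuel≤G (suc f) zero    = z≤n
widthFuel≤G (suc f) (suc k) = begin
  widthFuel (suc f) (2 * suc k)        ≡⟨ widthFuel-double f k ⟩
  p + widthFuel f (2 * r)              ≤⟨ +-monoʳ-≤ p (widthFuel≤G f r) ⟩
  p + G (2 * r)                        ≤⟨ +-monoʳ-≤ p (widthFuel-mono enough-fuel (2 * r)) ⟩
  p + widthFuel (2 * suc k) (2 * r)    ≡⟨ widthFuel-double (2 * suc k) k ⟨
  G (2 * suc k)                        ∎
  where
  open ≤-Reasoning
  p : ℕ
  p = greedyPart (suc k)
  r : ℕ
  r = greedyRest (suc k)
  enough-fuel : suc (2 * r) ≤ 2 * suc k
  enough-fuel = ≤-trans (s≤s (*-monoʳ-≤ 2 (≤-pred (greedyRest<self k))))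
                        (≤-trans (n≤1+n _) (≤-reflexive (sym (*-suc 2 k))))

Bound : ℕ → ℕ → Set
Bound w k = w ≤ 38 ⊎ 2 * (w * w) ≤ 9 * k

bound? : ∀ w k → Dec (Bound w k)
bound? w k = w ≤? 38 ⊎-dec 2 * (w * w) ≤? 9 * k

Bound-antitone : ∀ {v w k} → v ≤ w → Bound w k → Bound v k
Bound-antitone v≤w (inj₁ w≤38)  = inj₁ (≤-trans v≤w w≤38)
Bound-antitone v≤w (inj₂ 2w²≤9k) = inj₂ (≤-trans (*-monoʳ-≤ 2 (*-mono-≤ v≤w v≤w)) 2w²≤9k)

bound-table : (t : Fin 78) (j : Fin (toℕ t)) → Bound (toℕ t + G (2 * toℕ j)) (tri (toℕ t) + toℕ j)
bound-table = from-yes (all? {78} λ t → all? {toℕ t} λ j →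
  bound? (toℕ t + G (2 * toℕ j)) (tri (toℕ t) + toℕ j))

bound-small-part : ∀ {t j} → t < 78 → j < t → Bound (t + G (2 * j)) (tri t + j)
bound-small-part t<78 j<t with fromℕ< t<78 | toℕ-fromℕ< t<78
... | t | refl = subst (λ i → Bound (toℕ t + G (2 * i)) (tri (toℕ t) + i))
                       (toℕ-fromℕ< j<t) (bound-table t (fromℕ< j<t))

square-bound-of-≤38 : ∀ {t g} → 78 ≤ t → g ≤ 38 → 4 * ((t + g) * (t + g)) ≤ 9 * (t * (t ∸ 1))
square-bound-of-≤38 {t} {g} 78≤t g≤38 =
  subst (λ t → 4 * ((t + g) * (t + g)) ≤ 9 * (t * (t ∸ 1))) (m+[n∸m]≡n 78≤t) (shifted (t ∸ 78))
  where
  open ≤-Reasoning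
  -- The slack is 230 at s = 0: t = 78 is the least t with 4(t + 38)² ≤ 9t(t − 1).
  slack : ∀ s → 4 * ((78 + s + 38) * (78 + s + 38)) + (5 * s * s + 467 * s + 230)
              ≡ 9 * ((78 + s) * (77 + s))
  slack = solve-∀
  shifted : ∀ s → 4 * ((78 + s + g) * (78 + s + g)) ≤ 9 * ((78 + s) * (77 + s))
  shifted s = begin
    4 * ((78 + s + g) * (78 + s + g))                                  ≤⟨ *-monoʳ-≤ 4 (*-mono-≤ h h) ⟩
    4 * ((78 + s + 38) * (78 + s + 38))                                ≤⟨ m≤m+n _ _ ⟩
    4 * ((78 + s + 38) * (78 + s + 38)) + (5 * s * s + 467 * s + 230)  ≡⟨ slack s ⟩
    9 * ((78 + s) * (77 + s))                                          ∎
    where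
    h : 78 + s + g ≤ 78 + s + 38
    h = +-monoʳ-≤ (78 + s) g≤38

square-bound-of-8*≤ : ∀ {t g} → 3 ≤ t → 8 * g ≤ t → 4 * ((t + g) * (t + g)) ≤ 9 * (t * (t ∸ 1))
square-bound-of-8*≤ {t} {g} 3≤t 8g≤t = *-cancelˡ-≤ 64 (begin
  64 * (4 * ((t + g) * (t + g)))       ≡⟨ scale t g ⟩
  4 * ((8 * (t + g)) * (8 * (t + g)))  ≤⟨ *-monoʳ-≤ 4 (*-mono-≤ 8[t+g]≤9t 8[t+g]≤9t) ⟩
  4 * ((9 * t) * (9 * t))              ≤⟨ 324t²≤576t[t∸1] ⟩
  64 * (9 * (t * (t ∸ 1)))             ∎)
  where
  open ≤-Reasoning
  8[t+g]≤9t : 8 * (t + g) ≤ 9 * t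
  8[t+g]≤9t = begin
    8 * (t + g)    ≡⟨ *-distribˡ-+ 8 t g ⟩
    8 * t + 8 * g  ≤⟨ +-monoʳ-≤ (8 * t) 8g≤t ⟩
    8 * t + t      ≡⟨ +-comm (8 * t) t ⟩
    9 * t          ∎
  scale : ∀ t g → 64 * (4 * ((t + g) * (t + g))) ≡ 4 * ((8 * (t + g)) * (8 * (t + g)))
  scale = solve-∀
  slack : ∀ s → 4 * ((9 * (3 + s)) * (9 * (3 + s))) + 36 * ((3 + s) * (5 + 7 * s))
              ≡ 64 * (9 * ((3 + s) * (2 + s)))
  slack = solve-∀
  shifted : ∀ s → 4 * ((9 * (3 + s)) * (9 * (3 + s))) ≤ 64 * (9 * ((3 + s) * (2 + s)))
  shifted s = subst (4 * ((9 * (3 + s)) * (9 * (3 + s))) ≤_) (slack s) (m≤m+n _ _)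
  324t²≤576t[t∸1] : 4 * ((9 * t) * (9 * t)) ≤ 64 * (9 * (t * (t ∸ 1)))
  324t²≤576t[t∸1] = subst (λ t → 4 * ((9 * t) * (9 * t)) ≤ 64 * (9 * (t * (t ∸ 1))))
    (m+[n∸m]≡n 3≤t) (shifted (t ∸ 3))

8*≤-of-square≤ : ∀ {t j g} → 39 ≤ g → 2 * (g * g) ≤ 9 * j → j < t → 8 * g ≤ t
8*≤-of-square≤ {t} {j} {g} 39≤g 2g²≤9j j<t = *-cancelˡ-≤ 9 (begin
  9 * (8 * g)     ≡⟨ *-assoc 9 8 g ⟨
  72 * g          ≤⟨ *-monoˡ-≤ g (m≤m+n 72 6) ⟩
  78 * g          ≡⟨ *-assoc 2 39 g ⟩
  2 * (39 * g)    ≤⟨ *-monoʳ-≤ 2 (*-monoˡ-≤ g 39≤g) ⟩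
  2 * (g * g)     ≤⟨ 2g²≤9j ⟩
  9 * j           ≤⟨ *-monoʳ-≤ 9 (<⇒≤ j<t) ⟩
  9 * t           ∎)
  where open ≤-Reasoning

square-bound : ∀ {t j g} → 78 ≤ t → j < t → Bound g j → 4 * ((t + g) * (t + g)) ≤ 9 * (t * (t ∸ 1))
square-bound 78≤t j<t (inj₁ g≤38) = square-bound-of-≤38 78≤t g≤38
square-bound {g = g} 78≤t j<t (inj₂ 2g²≤9j) with g ≤? 38
... | yes g≤38 = square-bound-of-≤38 78≤t g≤38
... | no  g≰38 = square-bound-of-8*≤ (≤-trans (m≤m+n 3 75) 78≤t)
                                   (8*≤-of-square≤ (≰⇒> g≰38) 2g²≤9j j<t)

bound-large-part : ∀ {t j g} → 78 ≤ t → j < t → Bound g j → 2 * ((t + g) * (t + g)) ≤ 9 * (tri t + j)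
bound-large-part {t} {j} {g} 78≤t j<t bound-g = *-cancelˡ-≤ 2 (begin
  2 * (2 * ((t + g) * (t + g)))  ≡⟨ *-assoc 2 2 ((t + g) * (t + g)) ⟨
  4 * ((t + g) * (t + g))        ≤⟨ square-bound 78≤t j<t bound-g ⟩
  9 * (t * (t ∸ 1))              ≡⟨ cong (9 *_) (n*[n∸1]≡2*tri t) ⟩
  9 * (2 * tri t)                ≡⟨ *-assoc 9 2 (tri t) ⟨
  18 * tri t                     ≡⟨ *-assoc 2 9 (tri t) ⟩
  2 * (9 * tri t)                ≤⟨ *-monoʳ-≤ 2 (*-monoʳ-≤ 9 (m≤m+n (tri t) j)) ⟩
  2 * (9 * (tri t + j))          ∎)
  where open ≤-Reasoning

Bound-widthFuel : ∀ f k → Bound (widthFuel f (2 * k)) k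
Bound-widthFuel zero    k       = inj₁ z≤n
Bound-widthFuel (suc f) zero    = inj₁ z≤n
Bound-widthFuel (suc f) (suc k) =
  subst₂ Bound (sym (widthFuel-double f k)) (tri-greedyPart+greedyRest (suc k)) bound-split
  where
  p : ℕ
  p = greedyPart (suc k)
  r : ℕ
  r = greedyRest (suc k)
  bound-split : Bound (p + widthFuel f (2 * r)) (tri p + r)
  bound-split with p <? 78
  ... | yes p<78 = Bound-antitone {k = tri p + r} (+-monoʳ-≤ p (widthFuel≤G f r))
                                  (bound-small-part p<78 (greedyRest<greedyPart (suc k)))
  ... | no  p≮78 = inj₂ (bound-large-part {g = widthFuel f (2 * r)} (≮⇒≥ p≮78)
                               (greedyRest<greedyPart (suc k)) (Bound-widthFuel f r))

proposition1 : (m : ℕ) → G (2 * m) ≤ 38 ⊎ 2 * (G (2 * m) * G (2 * m)) ≤ 9 * m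
proposition1 m = Bound-widthFuel (suc (2 * m)) m
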